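{- Let $F$ be a finite set of facilities, $D$ a finite set of clients, $c$ a metric on $F\cup D$, and $f:F\to\mathbb{Q}_{\ge0}$ opening costs. Let $(S_{\mathcal{O}},\sigma_{\mathcal{O}})$ be an optimal solution of the $\emptyset$-facility location problem on this instance, i.e., $S_{\mathcal{O}}\subseteq F$, $\sigma_{\mathcal{O}}:D\to S_{\mathcal{O}}$ with $|\sigma_{\mathcal{O}}^{ -1}(i)|$ even for all $i\in S_{\mathcal{O}}$, minimizing $f(S_{\mathcal{O}})+c(\sigma_{\mathcal{O}})$. Then there exists a perfect matching $M$ on $D$ such that $\sum_{(j_1,j_2)\in M}c(j_1,j_2)\le c(\sigma_{\mathcal{O}})$.
   Context: For an assignment $\sigma:D\to S$, $c(\sigma):=\sum_{j\in D}c(\sigma(j),j)$. A perfect matching on $D$ is a partition of $D$ into unordered pairs. -}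

module Defs where

open import Data.Nat using (ℕ)
open import Data.Nat.Divisibility using (_∣_)
open import Data.Fin using (Fin) renaming (_≟_ to _≟ᶠ_)
open import Data.Fin.Subset using (Subset; _∈_; inside; outside)
open import Data.Vec using (lookup)
open import Data.Rational using (ℚ; 0ℚ; _+_; _≤_)
open import Data.Sum using (_⊎_; inj₁; inj₂)
open import Data.Product using (_×_; _,_; Σ; proj₁)
open import Data.List using (List; []; _∷_; length; filter; foldr; map; concatMap)
open import Data.List.Relation.Binary.Permutation.Propositional using (_↭_)
open import Data.Fin.Subset using (Side)
open import Relation.Binary.PropositionalEquality using (_≡_)
open import Relation.Nullary using (¬_)

open import Data.List using (allFin) public

Σℚ : (n : ℕ) → (Fin n → ℚ) → ℚ
Σℚ n g = foldr (λ k acc → g k + acc) 0ℚ (allFin n)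

-- Points of the instance: F ⊎ D, with F = Fin m facilities, D = Fin n clients
Point : ℕ → ℕ → Set
Point m n = Fin m ⊎ Fin n

record IsMetric {X : Set} (c : X → X → ℚ) : Set where
  field
    nonneg   : ∀ x y → 0ℚ ≤ c x y
    zero-iff : ∀ x y → c x y ≡ 0ℚ → x ≡ y
    refl0    : ∀ x → c x x ≡ 0ℚ
    symm     : ∀ x y → c x y ≡ c y x
    triangle : ∀ x y z → c x z ≤ c x y + c y z

sideCost : Side → ℚ → ℚ
sideCost inside  q = q
sideCost outside q = 0ℚ

openCost : {m : ℕ} → (Fin m → ℚ) → Subset m → ℚ
openCost {m} f S = Σℚ m (λ i → sideCost (lookup S i) (f i))

assignCost : {m n : ℕ} → (Point m n → Point m n → ℚ) → (Fin n → Fin m) → ℚ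
assignCost {m} {n} c σ = Σℚ n (λ j → c (inj₁ (σ j)) (inj₂ j))

fiberSize : {m n : ℕ} → (Fin n → Fin m) → Fin m → ℕ
fiberSize {m} {n} σ i = length (filter (λ j → σ j ≟ᶠ i) (allFin n))

Feasible : {m n : ℕ} → Subset m → (Fin n → Fin m) → Set
Feasible S σ = (∀ j → σ j ∈ S) × (∀ i → i ∈ S → 2 ∣ fiberSize σ i)

totalCost : {m n : ℕ} → (Point m n → Point m n → ℚ) → (Fin m → ℚ) →
            Subset m → (Fin n → Fin m) → ℚ
totalCost c f S σ = openCost f S + assignCost c σ

Optimal : {m n : ℕ} → (Point m n → Point m n → ℚ) → (Fin m → ℚ) →
          Subset m → (Fin n → Fin m) → Set
Optimal {m} {n} c f S σ =
  Feasible S σ ×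
  (∀ (S' : Subset m) (σ' : Fin n → Fin m) → Feasible S' σ' →
     totalCost c f S σ ≤ totalCost c f S' σ')

-- A perfect matching on D = Fin n: a list of pairs {j₁, j₂} partitioning D,
-- i.e. the list of all endpoints is a permutation of the list of all clients
-- (so each client occurs in exactly one pair, and j₁ ≠ j₂ in each pair).
endpoints : {n : ℕ} → List (Fin n × Fin n) → List (Fin n)
endpoints = concatMap (λ { (a , b) → a ∷ b ∷ [] })

IsPerfectMatching : (n : ℕ) → List (Fin n × Fin n) → Set
IsPerfectMatching n M = endpoints M ↭ allFin n

matchingCost : {m n : ℕ} → (Point m n → Point m n → ℚ) → List (Fin n × Fin n) → ℚ
matchingCost c M = foldr (λ { (a , b) acc → c (inj₂ a) (inj₂ b) + acc }) 0ℚ M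

-- Clients sharing a facility can be paired among themselves, since every
-- fibre of σ has even size; a pair {a, b} with σ a = σ b = i costs at most
-- c(a, i) + c(i, b) by the triangle inequality, so the total cost of the
-- pairing is at most c(σ). Only feasibility of (S, σ) is needed, not optimality.
module Submission where

open import Defs
open import Data.Nat using (ℕ; suc; _<_)
open import Data.Nat.Properties using (n<1+n; m<n⇒m<1+n)
open import Data.Nat.Divisibility using (_∣_; divides; ∣1⇒≡1; ∣m+n∣m⇒∣n; ∣-refl)
open import Data.Nat.Induction using (<-wellFounded)
open import Induction.WellFounded using (Acc; acc)
open import Data.Fin using (Fin; _≟_)
open import Data.Fin.Subset using (Subset; _∈_)
open import Data.Fin.Subset.Properties using (_∈?_)
open import Data.Rational using (ℚ; 0ℚ; _≤_; _+_)
import Data.Rational.Properties as ℚ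
open import Data.Product using (Σ; ∃₂; _×_; _,_)
open import Data.Sum using (inj₁; inj₂)
open import Data.List using (List; []; _∷_; length; filter; foldr; map)
open import Data.List.Properties using (filter-accept; filter-reject; foldr-map)
open import Data.List.Relation.Binary.Permutation.Propositional
  using (_↭_; ↭-refl; ↭-prep; ↭-swap; ↭-sym; ↭-trans; ↭⇒↭ₛ)
open import Data.List.Relation.Binary.Permutation.Propositional.Properties
  using (↭-length; filter-↭; map⁺)
import Data.List.Relation.Binary.Permutation.Setoid.Properties as Setoid↭
open import Relation.Binary.PropositionalEquality
  using (_≡_; _≢_; refl; sym; trans; cong; subst; setoid; module ≡-Reasoning)
open import Relation.Nullary using (yes; no)
open import Data.Empty using (⊥-elim)

module _ {a} {A : Set a} {m : ℕ} (σ : A → Fin m) where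

  fiberCount : Fin m → List A → ℕ
  fiberCount i L = length (filter (λ j → σ j ≟ i) L)

  EvenFibers : List A → Set
  EvenFibers L = ∀ i → 2 ∣ fiberCount i L

  fiberCount-↭ : ∀ i {L L′} → L ↭ L′ → fiberCount i L ≡ fiberCount i L′
  fiberCount-↭ i p = ↭-length (filter-↭ (λ j → σ j ≟ i) p)

  fiberCount-∉image : ∀ i L → (∀ j → σ j ≢ i) → fiberCount i L ≡ 0
  fiberCount-∉image i []      _ = refl
  fiberCount-∉image i (j ∷ L) h
    rewrite filter-reject (λ k → σ k ≟ i) {j} {L} (h j) = fiberCount-∉image i L h

  fiberCount≢0⇒extract : ∀ i L → fiberCount i L ≢ 0 →
                         ∃₂ λ b R → σ b ≡ i × L ↭ b ∷ R
  fiberCount≢0⇒extract i []      ne = ⊥-elim (ne refl)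
  fiberCount≢0⇒extract i (j ∷ L) ne with σ j ≟ i
  ... | yes σj≡i = j , L , σj≡i , ↭-refl
  ... | no _ with fiberCount≢0⇒extract i L ne
  ...   | b , R , σb≡i , p = b , j ∷ R , σb≡i , ↭-trans (↭-prep j p) (↭-swap j b ↭-refl)

  evenFibers⇒partner : ∀ a L → EvenFibers (a ∷ L) → ∃₂ λ b R → σ b ≡ σ a × L ↭ b ∷ R
  evenFibers⇒partner a L even = fiberCount≢0⇒extract (σ a) L fiber≢0
    where
    fiberCount-∷ : fiberCount (σ a) (a ∷ L) ≡ suc (fiberCount (σ a) L)
    fiberCount-∷ = cong length (filter-accept (λ j → σ j ≟ σ a) refl)

    fiber≢0 : fiberCount (σ a) L ≢ 0
    fiber≢0 empty with ∣1⇒≡1 (subst (2 ∣_) (trans fiberCount-∷ (cong suc empty)) (even (σ a)))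
    ... | ()

  even-dropPair : ∀ i {a b R} → σ a ≡ σ b →
                  2 ∣ fiberCount i (a ∷ b ∷ R) → 2 ∣ fiberCount i R
  even-dropPair i {a} {b} σa≡σb even with σ a ≟ i
  ... | yes σa≡i with σ b ≟ i
  ...   | yes _    = ∣m+n∣m⇒∣n even ∣-refl
  ...   | no σb≢i  = ⊥-elim (σb≢i (trans (sym σa≡σb) σa≡i))
  even-dropPair i {a} {b} σa≡σb even | no σa≢i with σ b ≟ i
  ...   | yes σb≡i = ⊥-elim (σa≢i (trans σa≡σb σb≡i))
  ...   | no _     = even

  evenFibers-dropPair : ∀ {a b R} → σ a ≡ σ b → EvenFibers (a ∷ b ∷ R) → EvenFibers R
  evenFibers-dropPair σa≡σb even i = even-dropPair i σa≡σb (even i)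

  evenFibers-↭ : ∀ {L L′} → L ↭ L′ → EvenFibers L → EvenFibers L′
  evenFibers-↭ p even i = subst (2 ∣_) (fiberCount-↭ i p) (even i)

module _ {m n : ℕ} (c : Point m n → Point m n → ℚ) (isMetric : IsMetric c)
         (σ : Fin n → Fin m) where
  open IsMetric isMetric

  clientCost : Fin n → ℚ
  clientCost j = c (inj₁ (σ j)) (inj₂ j)

  clientsCost : List (Fin n) → ℚ
  clientsCost = foldr (λ j acc → clientCost j + acc) 0ℚ

  clientsCost-↭ : ∀ {L L′} → L ↭ L′ → clientsCost L ≡ clientsCost L′
  clientsCost-↭ {L} {L′} p = begin
    clientsCost L                    ≡⟨ foldr-map _+_ clientCost 0ℚ L ⟨
    foldr _+_ 0ℚ (map clientCost L)  ≡⟨ sumPermutation (↭⇒↭ₛ (map⁺ clientCost p)) ⟩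
    foldr _+_ 0ℚ (map clientCost L′) ≡⟨ foldr-map _+_ clientCost 0ℚ L′ ⟩
    clientsCost L′                   ∎
    where
    open ≡-Reasoning
    sumPermutation = Setoid↭.foldr-commMonoid (setoid ℚ) ℚ.+-0-isCommutativeMonoid

  sameFacility⇒cost≤ : ∀ {a b} → σ a ≡ σ b →
                       c (inj₂ a) (inj₂ b) ≤ clientCost a + clientCost b
  sameFacility⇒cost≤ {a} {b} σa≡σb = begin
    c (inj₂ a) (inj₂ b)                               ≤⟨ triangle (inj₂ a) (inj₁ (σ a)) (inj₂ b) ⟩
    c (inj₂ a) (inj₁ (σ a)) + c (inj₁ (σ a)) (inj₂ b) ≡⟨ cong (_+ c (inj₁ (σ a)) (inj₂ b)) (symm (inj₂ a) (inj₁ (σ a))) ⟩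
    clientCost a + c (inj₁ (σ a)) (inj₂ b)            ≡⟨ cong (λ i → clientCost a + c (inj₁ i) (inj₂ b)) σa≡σb ⟩
    clientCost a + clientCost b                       ∎
    where open ℚ.≤-Reasoning

  CheapMatching : List (Fin n) → Set
  CheapMatching L =
    Σ (List (Fin n × Fin n)) λ M → endpoints M ↭ L × matchingCost c M ≤ clientsCost L

  evenFibers⇒matching : ∀ L → EvenFibers σ L → CheapMatching L
  evenFibers⇒matching L = go L (<-wellFounded (length L))
    where
    go : ∀ L → Acc _<_ (length L) → EvenFibers σ L → CheapMatching L
    go []      _         _    = [] , ↭-refl , ℚ.≤-refl
    go (a ∷ L) (acc rec) even with evenFibers⇒partner σ a L even
    ... | b , R , σb≡σa , L↭b∷R with go R (rec shorter) evenR
      where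
      shorter : length R < length (a ∷ L)
      shorter = subst (λ k → length R < suc k) (sym (↭-length L↭b∷R)) (m<n⇒m<1+n (n<1+n _))
      evenR : EvenFibers σ R
      evenR = evenFibers-dropPair σ (sym σb≡σa) (evenFibers-↭ σ (↭-prep a L↭b∷R) even)
    ...   | M , M↭R , costM =
      (a , b) ∷ M ,
      ↭-trans (↭-prep a (↭-prep b M↭R)) (↭-prep a (↭-sym L↭b∷R)) ,
      (begin
        c (inj₂ a) (inj₂ b) + matchingCost c M          ≤⟨ ℚ.+-mono-≤ (sameFacility⇒cost≤ (sym σb≡σa)) costM ⟩
        (clientCost a + clientCost b) + clientsCost R   ≡⟨ ℚ.+-assoc (clientCost a) (clientCost b) (clientsCost R) ⟩
        clientCost a + clientsCost (b ∷ R)              ≡⟨ cong (clientCost a +_) (clientsCost-↭ L↭b∷R) ⟨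
        clientsCost (a ∷ L)                             ∎)
      where open ℚ.≤-Reasoning

feasible⇒evenFibers : ∀ {m n} {S : Subset m} {σ : Fin n → Fin m} →
                      Feasible S σ → EvenFibers σ (allFin n)
feasible⇒evenFibers {S = S} {σ} (σ∈S , evenInS) i with i ∈? S
... | yes i∈S = evenInS i i∈S
... | no  i∉S = subst (2 ∣_) (sym (fiberCount-∉image σ i (allFin _) i∉image)) (divides 0 refl)
  where
  i∉image : ∀ j → σ j ≢ i
  i∉image j σj≡i = i∉S (subst (_∈ S) σj≡i (σ∈S j))

mainTheorem5 : (m n : ℕ) (c : Point m n → Point m n → ℚ) (f : Fin m → ℚ) →
    IsMetric c → (∀ i → 0ℚ ≤ f i) →
    (S : Subset m) (σ : Fin n → Fin m) → Optimal c f S σ →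
    Σ (List (Fin n × Fin n)) (λ M →
      IsPerfectMatching n M × (matchingCost c M ≤ assignCost c σ))
mainTheorem5 m n c f isMetric _ S σ (feasible , _) =
  evenFibers⇒matching c isMetric σ (allFin n) (feasible⇒evenFibers feasible)
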